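{- Let $G=(V,A)$ be a flow graph with start vertex $s$, let $F$ be a depth-first spanning tree of $G$ rooted at $s$ with vertices identified with their reverse-postorder numbers, let $H$ be the loop nesting forest defined by $F$, and let $T$ be a rooted tree with the parent property. Let $u\neq s$ and let $(v,w)\in A$ be an arc such that $w$ but not $v$ is a descendant of $u$ in $H$. Then $w$ is $u$ or a sibling of $u$ in $T$.
   Context: A flow graph is a finite directed graph $G=(V,A)$ with start vertex $s$ such that every vertex is reachable from $s$; there are no arcs entering $s$. $F$ is the spanning tree produced by a depth-first search of $G$ from $s$; vertices are numbered in reverse postorder. Ancestors/descendants include the vertex itself. The head $h(v)$ of $v$ is the maximum proper ancestor $u$ of $v$ in $F$ such that there is a path from $v$ to $u$ containing only descendants of $u$ in $F$; $h(v)$ is null if there is no such $u$. The loop nesting forest $H$ is the forest on $V$ in which the parent of $v$ is $h(v)$. For a rooted tree $T$ with vertex set contained in $V$, $t(v)$ denotes the parent of $v$; $T$ has the parent property if for every arc $(x,y)\in A$, $t(y)$ is an ancestor of $x$ in $T$. -}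

module Defs where

open import Data.Nat using (ℕ; suc)
open import Data.Fin using (Fin; zero; _<_; _≤_)
open import Data.Maybe using (Maybe; just; nothing)
open import Data.Product using (Σ; ∃; ∃-syntax; _×_; _,_)
open import Relation.Binary.PropositionalEquality using (_≡_; _≢_)
open import Relation.Binary.Construct.Closure.ReflexiveTransitive using (Star)
open import Relation.Nullary using (¬_)

Graph : ℕ → Set₁
Graph m = Fin m → Fin m → Set

ParentFn : ℕ → Set
ParentFn m = Fin m → Maybe (Fin m)

Child : ∀ {m} → ParentFn m → Fin m → Fin m → Set
Child t x y = t x ≡ just y

Anc : ∀ {m} → ParentFn m → Fin m → Fin m → Set
Anc t y x = Star (Child t) x y

ProperAnc : ∀ {m} → ParentFn m → Fin m → Fin m → Set
ProperAnc t y x = Anc t y x × y ≢ x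

-- Flow graph on Fin (suc n) with start vertex s = zero
-- (s gets reverse-postorder number 0): every vertex reachable from s,
-- no arc enters s.
IsFlowGraph : ∀ {n} → Graph (suc n) → Set
IsFlowGraph {n} A = ((v : Fin (suc n)) → Star A zero v) × ((v : Fin (suc n)) → ¬ A v zero)

-- Characterization: tree arcs are arcs of A, parents precede children,
-- every subtree is a contiguous interval of numbers starting at its root
-- (so the numbering is the reverse postorder of a traversal of f), and every
-- arc (x , y) with y ≤ x is a back arc (y is an ancestor of x), which is
-- exactly the depth-first condition.
record IsRPODFSTree {n : ℕ} (A : Graph (suc n)) (f : ParentFn (suc n)) : Set where
  field
    root-nothing : f zero ≡ nothing
    nonroot-parent : (v : Fin (suc n)) → v ≢ zero →
                     ∃[ p ] (f v ≡ just p × p < v × A p v)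
    subtree-interval : (v w x : Fin (suc n)) → Anc f v x → v ≤ w → w ≤ x → Anc f v w
    back-arcs : (x y : Fin (suc n)) → A x y → y ≤ x → Anc f y x

PathWithin : ∀ {m} → Graph m → ParentFn m → Fin m → Fin m → Fin m → Set
PathWithin A f u x y = Star (λ a b → A a b × Anc f u a × Anc f u b) x y

IsHead : ∀ {m} → Graph m → ParentFn m → Fin m → Fin m → Set
IsHead {m} A f v u =
  ProperAnc f u v × PathWithin A f u v u ×
  ((u' : Fin m) → ProperAnc f u' v → PathWithin A f u' v u' → u' ≤ u)

HDesc : ∀ {m} → Graph m → ParentFn m → Fin m → Fin m → Set
HDesc A f w u = Star (IsHead A f) w u

record RootedTree (m : ℕ) : Set₁ where
  field
    member : Fin m → Set
    parent : ParentFn m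
    root : Fin m
    root-member : member root
    root-parent : parent root ≡ nothing
    parent-member : (x y : Fin m) → parent x ≡ just y → member x × member y
    reaches-root : (x : Fin m) → member x → Star (Child parent) x root

TAnc : ∀ {m} → RootedTree m → Fin m → Fin m → Set
TAnc T y x = RootedTree.member T x × Anc (RootedTree.parent T) y x

ParentProperty : ∀ {m} → Graph m → RootedTree m → Set
ParentProperty {m} A T =
  (x y : Fin m) → A x y → ∃[ p ] (RootedTree.parent T y ≡ just p × TAnc T p x)

Sibling : ∀ {m} → RootedTree m → Fin m → Fin m → Set
Sibling T w u = w ≢ u × ∃[ p ] (RootedTree.parent T w ≡ just p × RootedTree.parent T u ≡ just p)

{-# OPTIONS --safe #-}
-- A T-parent is a T-ancestor of the F-parent, so T-ancestors are F-ancestors and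
-- t(x) < x. The parent property lets a T-ancestor z of the end of a path move back
-- to its start as long as the path stays in an F-subtree avoiding z. Along the
-- path w ⇝ u inside the F-subtree of u this makes t(u) a T-ancestor of t(w); along
-- the tree path u ⇝ w it makes t(w) a T-ancestor of t(u), because t(w) is not an
-- F-descendant of u: otherwise v would be one, and the path v → w ⇝ u inside the
-- subtree of u would make v an H-descendant of u. Hence t(u) = t(w).
module Submission where

open import Defs
open import Data.Nat using (ℕ; suc)
import Data.Nat.Properties as ℕ
open import Data.Fin using (Fin; zero; _<_; _≤_; _>_; _≟_)
open import Data.Fin.Properties using (≤-antisym; ≤∧≢⇒<)
open import Data.Fin.Induction using (<-wellFounded; >-wellFounded)
open import Induction.WellFounded using (Acc; acc)
open import Data.Maybe using (just; nothing)
open import Data.Maybe.Properties using (just-injective)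
open import Data.Product using (∃-syntax; _×_; _,_; proj₁)
open import Data.Sum using (_⊎_; inj₁; inj₂)
open import Relation.Binary.PropositionalEquality using (_≡_; _≢_; refl; sym; trans; cong)
open import Relation.Binary.Construct.Closure.ReflexiveTransitive using (Star; ε; _◅_; _◅◅_; gmap)
open import Relation.Nullary using (¬_; yes; no; contradiction)
open import Relation.Nullary.Decidable using (¬¬-excluded-middle)

Star-last : ∀ {a r} {X : Set a} {R : X → X → Set r} {x y : X} →
            Star R x y → x ≡ y ⊎ ∃[ z ] R z y
Star-last ε = inj₁ refl
Star-last (r ◅ rs) with Star-last rs
... | inj₁ refl = inj₂ (_ , r)
... | inj₂ last = inj₂ last

-- Path existence is not decidable, so maxima exist only under double negation;
-- this suffices because the hypothesis on v in the theorem is negative.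
¬¬-maximum : ∀ {n} (Q : Fin n → Set) {a : Fin n} → Q a →
             ¬ ¬ (∃[ b ] Q b × (∀ c → Q c → c ≤ b))
¬¬-maximum Q {a} qa = go a (>-wellFounded a) qa
  where
  go : ∀ a → Acc _>_ a → Q a → ¬ ¬ (∃[ b ] Q b × (∀ c → Q c → c ≤ b))
  go a (acc rs) qa k = ¬¬-excluded-middle {A = ∃[ c ] Q c × a < c} λ
    { (yes (c , qc , a<c)) → go c (rs a<c) qc k
    ; (no no-larger) → k (a , qa , λ c qc → ℕ.≮⇒≥ λ a<c → no-larger (c , qc , a<c)) }

ancestor-of-parent : ∀ {m} {t : ParentFn m} {z b q} →
                     Anc t z b → z ≢ b → t b ≡ just q → Anc t z q
ancestor-of-parent ε z≢b _ = contradiction refl z≢b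
ancestor-of-parent (tb≡q′ ◅ z-q′) _ tb≡q with refl ← just-injective (trans (sym tb≡q′) tb≡q) = z-q′

module DFSTree {n : ℕ} {A : Graph (suc n)} {f : ParentFn (suc n)} (dfs : IsRPODFSTree A f) where
  open IsRPODFSTree dfs

  parent-<×arc : ∀ {b c} → f b ≡ just c → c < b × A c b
  parent-<×arc {b} fb≡c with b ≟ zero
  ... | yes refl with () ← trans (sym root-nothing) fb≡c
  ... | no b≢s with nonroot-parent b b≢s
  ... | p , fb≡p , p<b , arc with refl ← just-injective (trans (sym fb≡p) fb≡c) = p<b , arc

  Anc⇒≤ : ∀ {a b} → Anc f a b → a ≤ b
  Anc⇒≤ ε = ℕ.≤-refl
  Anc⇒≤ (fb≡c ◅ a-c) = ℕ.<⇒≤ (ℕ.≤-<-trans (Anc⇒≤ a-c) (proj₁ (parent-<×arc fb≡c)))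

  PathWithin-weaken : ∀ {u h a b} → Anc f u h → PathWithin A f h a b → PathWithin A f u a b
  PathWithin-weaken u-h = gmap (λ x → x) λ (arc , h-a , h-b) → arc , h-a ◅◅ u-h , h-b ◅◅ u-h

  tree-path-within : ∀ {u h x} → Anc f h x → Anc f u h → PathWithin A f u h x
  tree-path-within ε _ = ε
  tree-path-within (fx≡c ◅ h-c) u-h with _ , arc ← parent-<×arc fx≡c =
    tree-path-within h-c u-h ◅◅ (arc , h-c ◅◅ u-h , (fx≡c ◅ h-c) ◅◅ u-h) ◅ ε

  HDesc⇒Anc×PathWithin : ∀ {w u} → HDesc A f w u → Anc f u w × PathWithin A f u w u
  HDesc⇒Anc×PathWithin ε = ε , ε
  HDesc⇒Anc×PathWithin (((h-w , _) , w⇝h , _) ◅ h∈Hu) with u-h , h⇝u ← HDesc⇒Anc×PathWithin h∈Hu =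
    h-w ◅◅ u-h , PathWithin-weaken u-h w⇝h ◅◅ h⇝u

  ¬¬-head-above : ∀ {u x} → u ≢ x → Anc f u x → PathWithin A f u x u →
                  ¬ ¬ (∃[ h ] IsHead A f x h × u ≤ h)
  ¬¬-head-above {u} {x} u≢x u-x x⇝u k =
    ¬¬-maximum (λ y → ProperAnc f y x × PathWithin A f y x y) ((u-x , u≢x) , x⇝u)
      λ (h , (h-x , x⇝h) , maximal) →
        k (h , (h-x , x⇝h , λ u′ u′-x x⇝u′ → maximal u′ (u′-x , x⇝u′)) , maximal u ((u-x , u≢x) , x⇝u))

  ¬¬-PathWithin⇒HDesc : ∀ {u x} → Anc f u x → PathWithin A f u x u → ¬ ¬ HDesc A f x u
  ¬¬-PathWithin⇒HDesc {u} {x} = go x (<-wellFounded x)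
    where
    go : ∀ x → Acc _<_ x → Anc f u x → PathWithin A f u x u → ¬ ¬ HDesc A f x u
    go x (acc rs) u-x x⇝u k with u ≟ x
    ... | yes refl = k ε
    ... | no u≢x = ¬¬-head-above u≢x u-x x⇝u λ (h , isHead@((h-x , h≢x) , _) , u≤h) →
      let u-h = subtree-interval u h x u-x u≤h (Anc⇒≤ h-x)
      in go h (rs (≤∧≢⇒< (Anc⇒≤ h-x) h≢x)) u-h (tree-path-within h-x u-h ◅◅ x⇝u) λ h∈Hu →
           k (isHead ◅ h∈Hu)

module ParentPropertyPaths {m : ℕ} {A : Graph m} (T : RootedTree m) (pp : ParentProperty A T) where
  open RootedTree T renaming (parent to t)

  T-ancestor-along-path : ∀ {f u a b z} → PathWithin A f u a b → Anc t z b → ¬ Anc f u z → Anc t z a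
  T-ancestor-along-path ε z-b _ = z-b
  T-ancestor-along-path ((arc , _ , u-y) ◅ y⇝b) z-b u⋢z with pp _ _ arc
  ... | c , ty≡c , _ , c-a =
    c-a ◅◅ ancestor-of-parent (T-ancestor-along-path y⇝b z-b u⋢z) (λ { refl → u⋢z u-y }) ty≡c

module DFSParentProperty {n : ℕ} {A : Graph (suc n)} (reach : ∀ v → Star A zero v)
                         {f : ParentFn (suc n)} (dfs : IsRPODFSTree A f)
                         (T : RootedTree (suc n)) (pp : ParentProperty A T) where
  open IsRPODFSTree dfs
  open DFSTree dfs
  open RootedTree T renaming (parent to t)

  -- Every vertex other than the start has an entering arc, hence a T-parent,
  -- so the root of T is the start vertex.
  T-parent-start : t zero ≡ nothing
  T-parent-start with Star-last (reach root)
  ... | inj₁ refl = root-parent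
  ... | inj₂ (c , arc) with _ , troot≡p , _ ← pp c root arc with () ← trans (sym root-parent) troot≡p

  T-parent-exists : ∀ {x} → x ≢ zero → ∃[ r ] t x ≡ just r
  T-parent-exists x≢s with p , _ , _ , arc ← nonroot-parent _ x≢s
                      with r , tx≡r , _ ← pp p _ arc = r , tx≡r

  T-parent-above-F-parent : ∀ {x q} → t x ≡ just q → ∃[ p ] f x ≡ just p × p < x × Anc t q p
  T-parent-above-F-parent {x} tx≡q with x ≟ zero
  ... | yes refl with () ← trans (sym T-parent-start) tx≡q
  ... | no x≢s with nonroot-parent x x≢s
  ... | p , fx≡p , p<x , arc with pp p x arc
  ... | q′ , tx≡q′ , _ , q′-p with refl ← just-injective (trans (sym tx≡q′) tx≡q) = p , fx≡p , p<x , q′-p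

  T-ancestor⇒F-ancestor : ∀ {y x} → Anc t y x → Anc f y x
  T-ancestor⇒F-ancestor {x = x} = go x (<-wellFounded x)
    where
    go : ∀ x → Acc _<_ x → ∀ {y} → Anc t y x → Anc f y x
    go x _ ε = ε
    go x (acc rs) (tx≡q ◅ y-q) with p , fx≡p , p<x , q-p ← T-parent-above-F-parent tx≡q =
      fx≡p ◅ go p (rs p<x) (q-p ◅◅ y-q)

  T-parent-< : ∀ {x q} → t x ≡ just q → q < x
  T-parent-< tx≡q with _ , _ , p<x , q-p ← T-parent-above-F-parent tx≡q =
    ℕ.≤-<-trans (Anc⇒≤ (T-ancestor⇒F-ancestor q-p)) p<x

lemma24 : {n : ℕ} (A : Graph (suc n)) → IsFlowGraph A →
            (f : ParentFn (suc n)) → IsRPODFSTree A f →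
            (T : RootedTree (suc n)) → ParentProperty A T →
            (u v w : Fin (suc n)) → u ≢ zero → A v w →
            HDesc A f w u → ¬ HDesc A f v u →
            w ≡ u ⊎ Sibling T w u
lemma24 A (reach , _) f dfs T pp u v w u≢s v→w w∈Hu v∉Hu with w ≟ u
... | yes w≡u = inj₁ w≡u
... | no w≢u with pp v w v→w | DFSParentProperty.T-parent-exists reach dfs T pp u≢s
... | q , tw≡q , _ , q-v | r , tu≡r with DFSTree.HDesc⇒Anc×PathWithin dfs w∈Hu
... | u-w , w⇝u = inj₂ (w≢u , q , tw≡q , trans tu≡r (cong just r≡q))
  where
  open DFSTree dfs
  open DFSParentProperty reach dfs T pp
  open ParentPropertyPaths T pp
  u⋢v : ¬ Anc f u v
  u⋢v u-v = ¬¬-PathWithin⇒HDesc u-v ((v→w , u-v , u-w) ◅ w⇝u) v∉Hu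
  u⋢q : ¬ Anc f u q
  u⋢q u-q = u⋢v (T-ancestor⇒F-ancestor q-v ◅◅ u-q)
  u⋢r : ¬ Anc f u r
  u⋢r u-r = ℕ.<⇒≱ (T-parent-< tu≡r) (Anc⇒≤ u-r)
  r-q : Anc (RootedTree.parent T) r q
  r-q = ancestor-of-parent (T-ancestor-along-path w⇝u (tu≡r ◅ ε) u⋢r) (λ { refl → u⋢r u-w }) tw≡q
  q-r : Anc (RootedTree.parent T) q r
  q-r = ancestor-of-parent (T-ancestor-along-path (tree-path-within u-w ε) (tw≡q ◅ ε) u⋢q)
                           (λ { refl → u⋢q ε }) tu≡r
  r≡q : r ≡ q
  r≡q = ≤-antisym (Anc⇒≤ (T-ancestor⇒F-ancestor r-q)) (Anc⇒≤ (T-ancestor⇒F-ancestor q-r))
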